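{- Let $B$ be an $(m+1)\times(m+1)$ alternating sign matrix, and let $A^{\min}$ be the $m\times m$ alternating sign matrix whose left corner sum matrix is $\bar A^{\min}_{i,j}=\max(\bar B_{i,j},\bar B_{i+1,j+1}-1)$ for $1\le i,j\le m$. Then for all $1\le i,j\le m+1$: if $B$ has an inversion at $(i,j)$, then $F(B)_{i,j}-F(A^{\min})_{i-1,j-1}=1$; otherwise $F(B)_{i,j}-F(A^{\min})_{i-1,j-1}=0$.
   Context: An alternating sign matrix (ASM) is a square matrix with entries in $\{0,1,-1\}$ whose row and column sums are all $1$ and whose nonzero entries alternate in sign along every row and column. For an $r\times r$ ASM $X$, its left corner sum matrix is $\bar X_{i,j}=\sum_{i'\le i,j'\le j}X_{i',j'}$, and $F(X)_{i,j}=\min(i,j)-\bar X_{i,j}$ for $1\le i,j\le r$; by convention $F(X)_{i,j}=0$ when $i=0$ or $j=0$. An inversion of $B$ is a position $(i,j)$ with $B_{i,j}=0$ such that the sum of entries of row $i$ strictly to the right of column $j$ is $1$ and the sum of entries of column $j$ strictly below row $i$ is $1$. -}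

module Defs where

open import Data.Nat using (ℕ; zero; suc; _<_; _<?_; _⊓_)
open import Data.Fin using (Fin; toℕ; fromℕ<)
open import Data.Integer using (ℤ; +_; -_; _+_; _-_; 0ℤ; 1ℤ; -1ℤ)
open import Data.Product using (_×_)
open import Data.Sum using (_⊎_)
open import Relation.Nullary using (¬_; yes; no)
open import Relation.Binary.PropositionalEquality using (_≡_)

Matrix : ℕ → Set
Matrix n = Fin n → Fin n → ℤ

EntriesOK : ∀ {n} → Matrix n → Set
EntriesOK X = ∀ i j → (X i j ≡ 0ℤ) ⊎ (X i j ≡ 1ℤ) ⊎ (X i j ≡ -1ℤ)

sumFin : ∀ {n} → (Fin n → ℤ) → ℤ
sumFin {zero}  f = 0ℤ
sumFin {suc n} f = f Fin.zero + sumFin (λ k → f (Fin.suc k))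

RowSumsOne : ∀ {n} → Matrix n → Set
RowSumsOne X = ∀ i → sumFin (λ j → X i j) ≡ 1ℤ

ColSumsOne : ∀ {n} → Matrix n → Set
ColSumsOne X = ∀ j → sumFin (λ i → X i j) ≡ 1ℤ

RowsAlternate : ∀ {n} → Matrix n → Set
RowsAlternate X = ∀ i (j j' : Fin _) → toℕ j < toℕ j' →
  ¬ (X i j ≡ 0ℤ) → ¬ (X i j' ≡ 0ℤ) →
  (∀ k → toℕ j < toℕ k → toℕ k < toℕ j' → X i k ≡ 0ℤ) →
  X i j' ≡ - X i j

ColsAlternate : ∀ {n} → Matrix n → Set
ColsAlternate X = ∀ j (i i' : Fin _) → toℕ i < toℕ i' →
  ¬ (X i j ≡ 0ℤ) → ¬ (X i' j ≡ 0ℤ) →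
  (∀ k → toℕ i < toℕ k → toℕ k < toℕ i' → X k j ≡ 0ℤ) →
  X i' j ≡ - X i j

IsASM : ∀ {n} → Matrix n → Set
IsASM X = EntriesOK X × RowSumsOne X × ColSumsOne X × RowsAlternate X × ColsAlternate X

-- Entry at 1-based position (i , j); 0 outside 1..n.
entry : ∀ {n} → Matrix n → ℕ → ℕ → ℤ
entry X zero j = 0ℤ
entry X (suc i) zero = 0ℤ
entry {n} X (suc i) (suc j) with i <? n | j <? n
... | yes p | yes q = X (fromℕ< p) (fromℕ< q)
... | yes _ | no _  = 0ℤ
... | no _  | _     = 0ℤ

sumUpTo : ℕ → (ℕ → ℤ) → ℤ
sumUpTo zero f = 0ℤ
sumUpTo (suc b) f = sumUpTo b f + f (suc b)

cornerSum : ∀ {n} → Matrix n → ℕ → ℕ → ℤ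
cornerSum X i j = sumUpTo i (λ a → sumUpTo j (λ b → entry X a b))

F : ∀ {n} → Matrix n → ℕ → ℕ → ℤ
F X i j = + (i ⊓ j) - cornerSum X i j

rightSum : ∀ {n} → Matrix n → ℕ → ℕ → ℤ
rightSum {n} X i j = sumUpTo n (λ b → entry X i b) - sumUpTo j (λ b → entry X i b)

belowSum : ∀ {n} → Matrix n → ℕ → ℕ → ℤ
belowSum {n} X i j = sumUpTo n (λ a → entry X a j) - sumUpTo i (λ a → entry X a j)

Inversion : ∀ {n} → Matrix n → ℕ → ℕ → Set
Inversion B i j = (entry B i j ≡ 0ℤ) × (rightSum B i j ≡ 1ℤ) × (belowSum B i j ≡ 1ℤ)

-- Write x = B̄(i-1,j-1) and t = B̄(i,j) − x, the sum of B over the hook formed by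
-- column j above row i and row i up to column j.  Then F(B)_{i,j} − F(A^min)_{i-1,j-1}
-- = 1 − t + max(0, t − 1) = max(0, 1 − t).  Prefix sums of rows and columns of an ASM
-- lie in {0, 1}, which leaves t ∈ {0, 1, 2} with t = 0 exactly when B has an inversion
-- at (i, j).  The same bounds let the defining formula of A^min extend to i − 1 = 0 or
-- j − 1 = 0, and in row or column m + 1 both F values vanish and no inversion exists.
module Submission where

open import Defs
open import Data.Nat as ℕ using (ℕ; zero; suc; _≤_; _<_; _∸_; z≤n; s≤s; _<?_)
import Data.Nat.Properties as ℕ
open import Data.Integer as ℤ using (ℤ; +_; _+_; _-_; -_; _⊔_; 0ℤ; 1ℤ; -1ℤ; +≤+)
import Data.Integer.Properties as ℤ
open import Data.Integer.Solver using (module +-*-Solver)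
open import Data.Fin using (Fin; toℕ; fromℕ<)
open import Data.Fin.Properties using (toℕ<n; fromℕ<-toℕ; toℕ-fromℕ<)
open import Data.Product using (Σ; ∃-syntax; _×_; _,_; proj₁; proj₂)
open import Data.Sum using (_⊎_; inj₁; inj₂)
open import Function using (_∘_)
open import Relation.Nullary using (¬_; yes; no; contradiction)
open import Relation.Binary.PropositionalEquality
open import Algebra.Properties.CommutativeSemigroup ℤ.+-commutativeSemigroup using (interchange)

sumUpTo-cong : ∀ k {f g : ℕ → ℤ} → (∀ a → a < k → f (suc a) ≡ g (suc a)) →
  sumUpTo k f ≡ sumUpTo k g
sumUpTo-cong zero    eq = refl
sumUpTo-cong (suc k) eq =
  cong₂ _+_ (sumUpTo-cong k (λ a a<k → eq a (ℕ.m<n⇒m<1+n a<k))) (eq k (ℕ.n<1+n k))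

sumUpTo-+ : ∀ k (f g : ℕ → ℤ) → sumUpTo k (λ a → f a + g a) ≡ sumUpTo k f + sumUpTo k g
sumUpTo-+ zero    f g = refl
sumUpTo-+ (suc k) f g = trans (cong (_+ (f (suc k) + g (suc k))) (sumUpTo-+ k f g))
  (interchange (sumUpTo k f) (sumUpTo k g) (f (suc k)) (g (suc k)))

sumUpTo-0 : ∀ k → sumUpTo k (λ _ → 0ℤ) ≡ 0ℤ
sumUpTo-0 zero    = refl
sumUpTo-0 (suc k) = cong (_+ 0ℤ) (sumUpTo-0 k)

sumUpTo-1 : ∀ k → sumUpTo k (λ _ → 1ℤ) ≡ + k
sumUpTo-1 zero    = refl
sumUpTo-1 (suc k) = trans (cong (_+ 1ℤ) (sumUpTo-1 k)) (cong +_ (ℕ.+-comm k 1))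

sumUpTo-comm : ∀ i j (f : ℕ → ℕ → ℤ) →
  sumUpTo i (λ a → sumUpTo j (f a)) ≡ sumUpTo j (λ b → sumUpTo i (λ a → f a b))
sumUpTo-comm zero    j f = sym (sumUpTo-0 j)
sumUpTo-comm (suc i) j f = trans (cong (_+ sumUpTo j (f (suc i))) (sumUpTo-comm i j f))
  (sym (sumUpTo-+ j (λ b → sumUpTo i (λ a → f a b)) (f (suc i))))

sumUpTo-suc : ∀ n (h : ℕ → ℤ) → sumUpTo (suc n) h ≡ h 1 + sumUpTo n (h ∘ suc)
sumUpTo-suc zero    h = ℤ.+-comm 0ℤ (h 1)
sumUpTo-suc (suc n) h = trans (cong (_+ h (suc (suc n))) (sumUpTo-suc n h))
  (ℤ.+-assoc (h 1) (sumUpTo n (h ∘ suc)) (h (suc (suc n))))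

sumUpTo≡sumFin : ∀ n {h : ℕ → ℤ} {f : Fin n → ℤ} → (∀ k → h (suc (toℕ k)) ≡ f k) →
  sumUpTo n h ≡ sumFin f
sumUpTo≡sumFin zero    eq = refl
sumUpTo≡sumFin (suc n) {h} eq = trans (sumUpTo-suc n h)
  (cong₂ _+_ (eq Fin.zero) (sumUpTo≡sumFin n {h ∘ suc} (eq ∘ Fin.suc)))

data Bit : ℤ → Set where
  bit₀ : Bit 0ℤ
  bit₁ : Bit 1ℤ

data Sign : ℤ → Set where
  sgn₀ : Sign 0ℤ
  sgn₊ : Sign 1ℤ
  sgn₋ : Sign -1ℤ

entry-fin : ∀ {n} (X : Matrix n) (a b : Fin n) → entry X (suc (toℕ a)) (suc (toℕ b)) ≡ X a b
entry-fin {n} X a b with toℕ a <? n | toℕ b <? n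
... | yes p | yes q = cong₂ X (fromℕ<-toℕ a p) (fromℕ<-toℕ b q)
... | yes _ | no b≮n = contradiction (toℕ<n b) b≮n
... | no a≮n | _     = contradiction (toℕ<n a) a≮n

⊎⇒Sign : ∀ {x} → (x ≡ 0ℤ) ⊎ (x ≡ 1ℤ) ⊎ (x ≡ -1ℤ) → Sign x
⊎⇒Sign (inj₁ refl)        = sgn₀
⊎⇒Sign (inj₂ (inj₁ refl)) = sgn₊
⊎⇒Sign (inj₂ (inj₂ refl)) = sgn₋

entry-sign : ∀ {n} (X : Matrix n) → EntriesOK X → ∀ a b → Sign (entry X a b)
entry-sign X ok zero    b       = sgn₀
entry-sign X ok (suc a) zero    = sgn₀
entry-sign {n} X ok (suc a) (suc b) with a <? n | b <? n
... | yes p | yes q = ⊎⇒Sign (ok (fromℕ< p) (fromℕ< q))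
... | yes _ | no _ = sgn₀
... | no _  | _    = sgn₀

-- Indices are 1-based, as in `entry`: the sequence is g 1, …, g n.
Alternating : ℕ → (ℕ → ℤ) → Set
Alternating n g = ∀ l t → l < t → t < n → g (suc l) ≢ 0ℤ → g (suc t) ≢ 0ℤ →
  (∀ s → l < s → s < t → g (suc s) ≡ 0ℤ) → g (suc t) ≡ - g (suc l)

latest : ℤ → ℤ → ℤ
latest ℓ e with e ℤ.≟ 0ℤ
... | yes _ = ℓ
... | no  _ = e

push : ℤ × ℤ → ℤ → ℤ × ℤ
push (ℓ , p) e = latest ℓ e , p + e

-- run g k = (last nonzero value among g 1, …, g k, or 0 if there is none ; g 1 + … + g k)
run : (ℕ → ℤ) → ℕ → ℤ × ℤ
run g zero    = 0ℤ , 0ℤ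
run g (suc k) = push (run g k) (g (suc k))

run-sum : ∀ g k → proj₂ (run g k) ≡ sumUpTo k g
run-sum g zero    = refl
run-sum g (suc k) = cong (_+ g (suc k)) (run-sum g k)

run-latest : ∀ g k → proj₁ (run g k) ≢ 0ℤ →
  ∃[ l ] l < k × g (suc l) ≡ proj₁ (run g k) × (∀ s → l < s → s < k → g (suc s) ≡ 0ℤ)
run-latest g zero ℓ≢0 = contradiction refl ℓ≢0
run-latest g (suc k) ℓ≢0 with g (suc k) ℤ.≟ 0ℤ
... | no _ = k , ℕ.n<1+n k , refl ,
      λ s k<s s<1+k → contradiction k<s (ℕ.≤⇒≯ (ℕ.s≤s⁻¹ s<1+k))
... | yes e≡0 with run-latest g k ℓ≢0
...   | l , l<k , gl≡ℓ , between = l , ℕ.m<n⇒m<1+n l<k , gl≡ℓ , between′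
  where
  between′ : ∀ s → l < s → s < suc k → g (suc s) ≡ 0ℤ
  between′ s l<s s<1+k with ℕ.m≤n⇒m<n∨m≡n (ℕ.s≤s⁻¹ s<1+k)
  ... | inj₁ s<k  = between s l<s s<k
  ... | inj₂ refl = e≡0

Alternates : ℤ → ℤ → Set
Alternates ℓ e = ℓ ≢ 0ℤ → e ≢ 0ℤ → e ≡ - ℓ

data Good : ℤ × ℤ → Set where
  empty : Good (0ℤ , 0ℤ)
  up    : Good (1ℤ , 1ℤ)
  down  : Good (-1ℤ , 0ℤ)

-- From these states an alternating sequence keeps its running sum in {-1, 0}.
data Stuck : ℤ × ℤ → Set where
  below : Stuck (-1ℤ , -1ℤ)
  level : Stuck (1ℤ , 0ℤ)

push-Good : ∀ {s e} → Sign e → Alternates (proj₁ s) e → Good s → Good (push s e) ⊎ Stuck (push s e)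
push-Good sgn₀ _   empty = inj₁ empty
push-Good sgn₊ _   empty = inj₁ up
push-Good sgn₋ _   empty = inj₂ below
push-Good sgn₀ _   up    = inj₁ up
push-Good sgn₊ alt up    = contradiction (alt (λ ()) (λ ())) λ ()
push-Good sgn₋ _   up    = inj₁ down
push-Good sgn₀ _   down  = inj₁ down
push-Good sgn₊ _   down  = inj₁ up
push-Good sgn₋ alt down  = contradiction (alt (λ ()) (λ ())) λ ()

push-Stuck : ∀ {s e} → Sign e → Alternates (proj₁ s) e → Stuck s → Stuck (push s e)
push-Stuck sgn₀ _   below = below
push-Stuck sgn₊ _   below = level
push-Stuck sgn₋ alt below = contradiction (alt (λ ()) (λ ())) λ ()
push-Stuck sgn₀ _   level = level
push-Stuck sgn₊ alt level = contradiction (alt (λ ()) (λ ())) λ ()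
push-Stuck sgn₋ _   level = below

Good-sum : ∀ {s} → Good s → Bit (proj₂ s)
Good-sum empty = bit₀
Good-sum up    = bit₁
Good-sum down  = bit₀

Stuck-sum : ∀ {s} → Stuck s → proj₂ s ≢ 1ℤ
Stuck-sum below ()
Stuck-sum level ()

module _ {n} {g : ℕ → ℤ} (sign : ∀ k → Sign (g k)) (alt : Alternating n g) where

  run-alternates : ∀ k → k < n → Alternates (proj₁ (run g k)) (g (suc k))
  run-alternates k k<n ℓ≢0 e≢0 with run-latest g k ℓ≢0
  ... | l , l<k , gl≡ℓ , between =
    trans (alt l k l<k k<n (ℓ≢0 ∘ trans (sym gl≡ℓ)) e≢0 between) (cong -_ gl≡ℓ)

  run-Good⊎Stuck : ∀ k → k ≤ n → Good (run g k) ⊎ Stuck (run g k)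
  run-Good⊎Stuck zero    _   = inj₁ empty
  run-Good⊎Stuck (suc k) k<n with run-Good⊎Stuck k (ℕ.<⇒≤ k<n)
  ... | inj₁ good  = push-Good (sign (suc k)) (run-alternates k k<n) good
  ... | inj₂ stuck = inj₂ (push-Stuck (sign (suc k)) (run-alternates k k<n) stuck)

  run-Stuck : ∀ d k → d ℕ.+ k ≤ n → Stuck (run g k) → Stuck (run g (d ℕ.+ k))
  run-Stuck zero    k _      stuck = stuck
  run-Stuck (suc d) k d+k<n stuck =
    push-Stuck (sign _) (run-alternates (d ℕ.+ k) d+k<n) (run-Stuck d k (ℕ.<⇒≤ d+k<n) stuck)

  sumUpTo-Bit : sumUpTo n g ≡ 1ℤ → ∀ k → k ≤ n → Bit (sumUpTo k g)
  sumUpTo-Bit total k k≤n with run-Good⊎Stuck k k≤n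
  ... | inj₁ good  = subst Bit (run-sum g k) (Good-sum good)
  ... | inj₂ stuck = contradiction (trans (run-sum g n) total) (Stuck-sum stuck-at-n)
    where
    stuck-at-n : Stuck (run g n)
    stuck-at-n = subst (Stuck ∘ run g) (ℕ.m∸n+n≡m k≤n)
      (run-Stuck (n ∸ k) k (ℕ.≤-reflexive (ℕ.m∸n+n≡m k≤n)) stuck)

finView : ∀ {n} a → a < n → Σ (Fin n) λ i → toℕ i ≡ a
finView a a<n = fromℕ< a<n , toℕ-fromℕ< a<n

module _ {n} {X : Matrix n} (asm : IsASM X) where
  private
    entriesOK = proj₁ asm
    rowSums   = proj₁ (proj₂ asm)
    colSums   = proj₁ (proj₂ (proj₂ asm))
    rowsAlt   = proj₁ (proj₂ (proj₂ (proj₂ asm)))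
    colsAlt   = proj₂ (proj₂ (proj₂ (proj₂ asm)))

  row-sum : ∀ a → a < n → sumUpTo n (entry X (suc a)) ≡ 1ℤ
  row-sum a a<n with finView a a<n
  ... | i , refl = trans (sumUpTo≡sumFin n (entry-fin X i)) (rowSums i)

  col-sum : ∀ b → b < n → sumUpTo n (λ a → entry X a (suc b)) ≡ 1ℤ
  col-sum b b<n with finView b b<n
  ... | j , refl = trans (sumUpTo≡sumFin n (λ k → entry-fin X k j)) (colSums j)

  row-alternating : ∀ a → a < n → Alternating n (entry X (suc a))
  row-alternating a a<n l t l<t t<n nzl nzt between
    with finView a a<n | finView l (ℕ.<-trans l<t t<n) | finView t t<n
  ... | i , refl | j , refl | j′ , refl = begin
    entry X _ (suc (toℕ j′)) ≡⟨ entry-fin X i j′ ⟩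
    X i j′                   ≡⟨ rowsAlt i j j′ l<t (nzl ∘ trans (entry-fin X i j))
                                  (nzt ∘ trans (entry-fin X i j′))
                                  (λ k j<k k<j′ → trans (sym (entry-fin X i k)) (between (toℕ k) j<k k<j′)) ⟩
    - X i j                  ≡⟨ cong -_ (entry-fin X i j) ⟨
    - entry X _ (suc (toℕ j)) ∎
    where open ≡-Reasoning

  col-alternating : ∀ b → b < n → Alternating n (λ a → entry X a (suc b))
  col-alternating b b<n l t l<t t<n nzl nzt between
    with finView b b<n | finView l (ℕ.<-trans l<t t<n) | finView t t<n
  ... | j , refl | i , refl | i′ , refl = begin
    entry X (suc (toℕ i′)) _ ≡⟨ entry-fin X i′ j ⟩
    X i′ j                   ≡⟨ colsAlt j i i′ l<t (nzl ∘ trans (entry-fin X i j))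
                                  (nzt ∘ trans (entry-fin X i′ j))
                                  (λ k i<k k<i′ → trans (sym (entry-fin X k j)) (between (toℕ k) i<k k<i′)) ⟩
    - X i j                  ≡⟨ cong -_ (entry-fin X i j) ⟨
    - entry X (suc (toℕ i)) _ ∎
    where open ≡-Reasoning

  row-prefix-Bit : ∀ a → a < n → ∀ k → k ≤ n → Bit (sumUpTo k (entry X (suc a)))
  row-prefix-Bit a a<n =
    sumUpTo-Bit (entry-sign X entriesOK (suc a)) (row-alternating a a<n) (row-sum a a<n)

  col-prefix-Bit : ∀ b → b < n → ∀ k → k ≤ n → Bit (sumUpTo k (λ a → entry X a (suc b)))
  col-prefix-Bit b b<n =
    sumUpTo-Bit (λ a → entry-sign X entriesOK a (suc b)) (col-alternating b b<n) (col-sum b b<n)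

  cornerSum-lastCol : ∀ i → i ≤ n → cornerSum X i n ≡ + i
  cornerSum-lastCol i i≤n =
    trans (sumUpTo-cong i (λ a a<i → row-sum a (ℕ.<-≤-trans a<i i≤n))) (sumUpTo-1 i)

  cornerSum-lastRow : ∀ j → j ≤ n → cornerSum X n j ≡ + j
  cornerSum-lastRow j j≤n = trans (sumUpTo-comm n j (entry X))
    (trans (sumUpTo-cong j (λ b b<j → col-sum b (ℕ.<-≤-trans b<j j≤n))) (sumUpTo-1 j))

  F-lastCol : ∀ i → i ≤ n → F X i n ≡ 0ℤ
  F-lastCol i i≤n = trans (cong₂ _-_ (cong +_ (ℕ.m≤n⇒m⊓n≡m i≤n)) (cornerSum-lastCol i i≤n))
    (ℤ.+-inverseʳ (+ i))

  F-lastRow : ∀ j → j ≤ n → F X n j ≡ 0ℤ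
  F-lastRow j j≤n = trans (cong₂ _-_ (cong +_ (ℕ.m≥n⇒m⊓n≡n j≤n)) (cornerSum-lastRow j j≤n))
    (ℤ.+-inverseʳ (+ j))

noInversion-lastRow : ∀ {n} (X : Matrix n) j → ¬ Inversion X n j
noInversion-lastRow {n} X j (_ , _ , below≡1) =
  contradiction (trans (sym (ℤ.+-inverseʳ (sumUpTo n (λ a → entry X a j)))) below≡1) λ ()

noInversion-lastCol : ∀ {n} (X : Matrix n) i → ¬ Inversion X i n
noInversion-lastCol {n} X i (_ , right≡1 , _) =
  contradiction (trans (sym (ℤ.+-inverseʳ (sumUpTo n (entry X i)))) right≡1) λ ()

hook : ∀ {n} → Matrix n → ℕ → ℕ → ℤ
hook X i j = sumUpTo i (λ a → entry X a (suc j)) + sumUpTo (suc j) (entry X (suc i))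

cornerSum-suc : ∀ {n} (X : Matrix n) i j → cornerSum X (suc i) (suc j) ≡ cornerSum X i j + hook X i j
cornerSum-suc X i j = trans
  (cong (_+ sumUpTo (suc j) (entry X (suc i))) (sumUpTo-+ i (λ a → sumUpTo j (entry X a)) (λ a → entry X a (suc j))))
  (ℤ.+-assoc (cornerSum X i j) _ _)

cornerSum-0ʳ : ∀ {n} (X : Matrix n) i → cornerSum X i 0 ≡ 0ℤ
cornerSum-0ʳ X i = sumUpTo-0 i

cornerSum-firstRow : ∀ {n} (X : Matrix n) j → cornerSum X 1 j ≡ sumUpTo j (entry X 1)
cornerSum-firstRow X j = ℤ.+-identityˡ _

cornerSum-firstCol : ∀ {n} (X : Matrix n) i → cornerSum X i 1 ≡ sumUpTo i (λ a → entry X a 1)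
cornerSum-firstCol X i = sumUpTo-cong i (λ a _ → ℤ.+-identityˡ _)

F-difference : ∀ {n n′} (X : Matrix n) (Y : Matrix n′) i j →
  F X (suc i) (suc j) - F Y i j ≡ 1ℤ - cornerSum X (suc i) (suc j) + cornerSum Y i j
F-difference X Y i j = solve 3 (λ q y a → (con 1ℤ :+ q) :- y :- (q :- a) := con 1ℤ :- y :+ a)
  refl (+ (i ℕ.⊓ j)) (cornerSum X (suc i) (suc j)) (cornerSum Y i j)
  where open +-*-Solver

MinCorner : ∀ {n n′} → Matrix n → Matrix n′ → ℕ → ℕ → Set
MinCorner A B i j = cornerSum A i j ≡ cornerSum B i j ⊔ (cornerSum B (suc i) (suc j) - 1ℤ)

Bit⇒0⊔[y-1]≡0 : ∀ {y} → Bit y → 0ℤ ⊔ (y - 1ℤ) ≡ 0ℤ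
Bit⇒0⊔[y-1]≡0 bit₀ = refl
Bit⇒0⊔[y-1]≡0 bit₁ = refl

MinCorner-vanishing : ∀ {n n′} (A : Matrix n) (B : Matrix n′) i j →
  cornerSum A i j ≡ 0ℤ → cornerSum B i j ≡ 0ℤ → Bit (cornerSum B (suc i) (suc j)) → MinCorner A B i j
MinCorner-vanishing A B i j a≡0 x≡0 y = trans a≡0
  (trans (sym (Bit⇒0⊔[y-1]≡0 y)) (cong (_⊔ (cornerSum B (suc i) (suc j) - 1ℤ)) (sym x≡0)))

MinCorner-extend : ∀ {m} {A : Matrix m} {B : Matrix (suc m)} → IsASM B →
  (∀ i j → 1 ≤ i → i ≤ m → 1 ≤ j → j ≤ m → MinCorner A B i j) →
  ∀ i j → i < m → j < m → MinCorner A B i j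
MinCorner-extend {A = A} {B} asm min zero j _ j<m = MinCorner-vanishing A B 0 j refl refl
  (subst Bit (sym (cornerSum-firstRow B (suc j))) (row-prefix-Bit asm 0 (s≤s z≤n) (suc j) (s≤s (ℕ.<⇒≤ j<m))))
MinCorner-extend {A = A} {B} asm min (suc i) zero i<m _ =
  MinCorner-vanishing A B (suc i) 0 (cornerSum-0ʳ A (suc i)) (cornerSum-0ʳ B (suc i))
    (subst Bit (sym (cornerSum-firstCol B (suc (suc i))))
      (col-prefix-Bit asm 0 (s≤s z≤n) (suc (suc i)) (ℕ.m≤n⇒m≤1+n i<m)))
MinCorner-extend asm min (suc i) (suc j) i<m j<m =
  min (suc i) (suc j) (s≤s z≤n) (ℕ.<⇒≤ i<m) (s≤s z≤n) (ℕ.<⇒≤ j<m)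

1-[x+t]+[x⊔[x+t-1]]≡[1-t]⊔0 : ∀ x t → 1ℤ - (x + t) + (x ⊔ (x + t - 1ℤ)) ≡ (1ℤ - t) ⊔ 0ℤ
1-[x+t]+[x⊔[x+t-1]]≡[1-t]⊔0 x t = trans (ℤ.mono-≤-distrib-⊔ (ℤ.+-monoʳ-≤ (1ℤ - (x + t))) x (x + t - 1ℤ))
  (cong₂ _⊔_ (solve 2 (λ x t → con 1ℤ :- (x :+ t) :+ x := con 1ℤ :- t) refl x t)
             (solve 2 (λ x t → con 1ℤ :- (x :+ t) :+ (x :+ t :- con 1ℤ) := con 0ℤ) refl x t))
  where open +-*-Solver

MinCorner-difference : ∀ {n n′} (A : Matrix n) (B : Matrix n′) i j → MinCorner A B i j →
  F B (suc i) (suc j) - F A i j ≡ (1ℤ - hook B i j) ⊔ 0ℤ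
MinCorner-difference A B i j min = begin
  F B (suc i) (suc j) - F A i j                                 ≡⟨ F-difference B A i j ⟩
  1ℤ - y + cornerSum A i j                                      ≡⟨ cong (λ a → 1ℤ - y + a) min ⟩
  1ℤ - y + (x ⊔ (y - 1ℤ))                                       ≡⟨ cong (λ u → 1ℤ - u + (x ⊔ (u - 1ℤ))) (cornerSum-suc B i j) ⟩
  1ℤ - (x + hook B i j) + (x ⊔ (x + hook B i j - 1ℤ))           ≡⟨ 1-[x+t]+[x⊔[x+t-1]]≡[1-t]⊔0 x (hook B i j) ⟩
  (1ℤ - hook B i j) ⊔ 0ℤ                                        ∎
  where
  open ≡-Reasoning
  x = cornerSum B i j
  y = cornerSum B (suc i) (suc j)

-- R and C stand for the row and column totals in `rightSum` and `belowSum`.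
inversion-or-hook : ∀ {R C c s e} → R ≡ 1ℤ → C ≡ 1ℤ →
  Bit c → Bit s → Sign e → Bit (c + e) → Bit (s + e) →
  let inversion = e ≡ 0ℤ × R - (s + e) ≡ 1ℤ × C - (c + e) ≡ 1ℤ in
  (inversion × c + (s + e) ≡ 0ℤ) ⊎ (¬ inversion × 1ℤ ℤ.≤ c + (s + e))
inversion-or-hook refl refl bit₀ bit₀ sgn₀ _ _  = inj₁ ((refl , refl , refl) , refl)
inversion-or-hook refl refl bit₁ bit₀ sgn₀ _ _  = inj₂ ((λ { (_ , _ , ()) }) , ℤ.≤-refl)
inversion-or-hook refl refl bit₀ bit₁ sgn₀ _ _  = inj₂ ((λ { (_ , () , _) }) , ℤ.≤-refl)
inversion-or-hook refl refl bit₁ bit₁ sgn₀ _ _  = inj₂ ((λ { (_ , () , _) }) , +≤+ (s≤s z≤n))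
inversion-or-hook refl refl bit₀ bit₀ sgn₊ _ _  = inj₂ ((λ { (() , _) }) , ℤ.≤-refl)
inversion-or-hook refl refl bit₁ _    sgn₊ () _
inversion-or-hook refl refl bit₀ bit₁ sgn₊ _ ()
inversion-or-hook refl refl bit₁ bit₁ sgn₋ _ _  = inj₂ ((λ { (() , _) }) , ℤ.≤-refl)
inversion-or-hook refl refl bit₀ _    sgn₋ () _
inversion-or-hook refl refl bit₁ bit₀ sgn₋ _ ()

positive-part-cases : ∀ {P : Set} {d t} → d ≡ (1ℤ - t) ⊔ 0ℤ →
  (P × t ≡ 0ℤ) ⊎ (¬ P × 1ℤ ℤ.≤ t) → (P × d ≡ 1ℤ) ⊎ (¬ P × d ≡ 0ℤ)
positive-part-cases d≡ (inj₁ (p , refl))  = inj₁ (p , d≡)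
positive-part-cases d≡ (inj₂ (¬p , 1≤t)) = inj₂ (¬p , trans d≡ (ℤ.i≤j⇒i⊔j≡j (ℤ.i≤j⇒i-j≤0 1≤t)))

F-difference-interior : ∀ {m} {A : Matrix m} {B : Matrix (suc m)} → IsASM B →
  (∀ i j → 1 ≤ i → i ≤ m → 1 ≤ j → j ≤ m → MinCorner A B i j) → ∀ i j → i < m → j < m →
  (Inversion B (suc i) (suc j) × F B (suc i) (suc j) - F A i j ≡ 1ℤ) ⊎
  (¬ Inversion B (suc i) (suc j) × F B (suc i) (suc j) - F A i j ≡ 0ℤ)
F-difference-interior {A = A} {B} asm min i j i<m j<m = positive-part-cases
  (MinCorner-difference A B i j (MinCorner-extend asm min i j i<m j<m))
  (inversion-or-hook (row-sum asm i i<1+m) (col-sum asm j j<1+m)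
    (col-prefix-Bit asm j j<1+m i (ℕ.<⇒≤ i<1+m)) (row-prefix-Bit asm i i<1+m j (ℕ.<⇒≤ j<1+m))
    (entry-sign B (proj₁ asm) (suc i) (suc j))
    (col-prefix-Bit asm j j<1+m (suc i) i<1+m) (row-prefix-Bit asm i i<1+m (suc j) j<1+m))
  where
  i<1+m = ℕ.m<n⇒m<1+n i<m
  j<1+m = ℕ.m<n⇒m<1+n j<m

by-cases : ∀ {P : Set} {d : ℤ} → (P × d ≡ 1ℤ) ⊎ (¬ P × d ≡ 0ℤ) → (P → d ≡ 1ℤ) × (¬ P → d ≡ 0ℤ)
by-cases (inj₁ (p , d≡1))  = (λ _ → d≡1) , (λ ¬p → contradiction p ¬p)
by-cases (inj₂ (¬p , d≡0)) = (λ p → contradiction p ¬p) , (λ _ → d≡0)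

proposition6p3p1 : (m : ℕ) (B : Matrix (suc m)) (Amin : Matrix m) →
    IsASM B → IsASM Amin →
    (∀ i j → 1 ≤ i → i ≤ m → 1 ≤ j → j ≤ m →
      cornerSum Amin i j ≡ cornerSum B i j ⊔ (cornerSum B (suc i) (suc j) - 1ℤ)) →
    ∀ i j → 1 ≤ i → i ≤ suc m → 1 ≤ j → j ≤ suc m →
      (Inversion B i j → F B i j - F Amin (i ∸ 1) (j ∸ 1) ≡ 1ℤ) ×
      (¬ Inversion B i j → F B i j - F Amin (i ∸ 1) (j ∸ 1) ≡ 0ℤ)
proposition6p3p1 m B A asmB asmA min (suc i) (suc j) _ i<1+m _ j<1+m
  with ℕ.m≤n⇒m<n∨m≡n (ℕ.s≤s⁻¹ i<1+m) | ℕ.m≤n⇒m<n∨m≡n (ℕ.s≤s⁻¹ j<1+m)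
... | inj₁ i<m  | inj₁ j<m  = by-cases (F-difference-interior asmB min i j i<m j<m)
... | inj₂ refl | _         = by-cases (inj₂ (noInversion-lastRow B (suc j) ,
  cong₂ _-_ (F-lastRow asmB (suc j) j<1+m) (F-lastRow asmA j (ℕ.s≤s⁻¹ j<1+m))))
... | inj₁ _    | inj₂ refl = by-cases (inj₂ (noInversion-lastCol B (suc i) ,
  cong₂ _-_ (F-lastCol asmB (suc i) i<1+m) (F-lastCol asmA i (ℕ.s≤s⁻¹ i<1+m))))
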